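{- For every $n \ge 3$ and every integer $i \ge \lfloor n/2 \rfloor$: (i) if $\mathcal{P}_{n-1}^{i-1} = \emptyset$ and $\mathcal{P}_{n-2}^{i-1} \ne \emptyset$, then $\mathcal{P}_n^i = \{X \cup \{n-1\} : X \in \mathcal{P}_{n-2}^{i-1}\}$; (ii) if $\mathcal{P}_{n-1}^{i-1} \ne \emptyset$ and $\mathcal{P}_{n-2}^{i-1} \ne \emptyset$, then $\mathcal{P}_n^i = \{\{n\} \cup X_1 : X_1 \in \mathcal{P}_{n-1}^{i-1}\} \cup \{\{n-1\} \cup X_2 : X_2 \in \mathcal{P}_{n-2}^{i-1}\}$.
   Context: All graphs are finite and simple. For a connected graph $H$, a non-empty set $S \subseteq V(H)$ is a weakly connected dominating set of $H$ if the spanning subgraph of $H$ obtained by removing all edges joining two vertices of $V(H)\setminus S$ is connected. $P_n$ is the path with vertex set $[n]=\{1,\dots,n\}$ and edges $\{k,k+1\}$ for $1\le k\le n-1$. $\mathcal{P}_n^i$ denotes the family of weakly connected dominating sets of $P_n$ of cardinality $i$. -}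

module Defs where

open import Data.Nat using (ℕ; zero; suc; _≡ᵇ_)
open import Data.Fin using (Fin; toℕ; fromℕ; inject₁)
open import Data.Fin.Subset using (Subset; _∈_; Nonempty; ∣_∣; _∪_; ⁅_⁆)
open import Data.Vec using (_∷ʳ_)
open import Data.Bool using (false)
open import Data.Product using (_×_; ∃)
open import Data.Sum using (_⊎_)
open import Relation.Binary.PropositionalEquality using (_≡_)
open import Relation.Binary.Construct.Closure.ReflexiveTransitive using (Star)
open import Relation.Nullary using (¬_)

-- Vertex k ∈ [n] of P_n is represented by the index (k-1) : Fin n.
-- Adjacency of the path P_n: u ~ v iff |u - v| = 1.
PathAdj : (n : ℕ) → Fin n → Fin n → Set
PathAdj n u v = (toℕ v ≡ suc (toℕ u)) ⊎ (toℕ u ≡ suc (toℕ v))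

WeakAdj : (n : ℕ) → Subset n → Fin n → Fin n → Set
WeakAdj n S u v = PathAdj n u v × (u ∈ S ⊎ v ∈ S)

Connected : (n : ℕ) → (Fin n → Fin n → Set) → Set
Connected n R = ∀ u v → Star R u v

IsWCDS : (n : ℕ) → Subset n → Set
IsWCDS n S = Nonempty S × Connected n (WeakAdj n S)

InFam : (n i : ℕ) → Subset n → Set
InFam n i S = IsWCDS n S × ∣ S ∣ ≡ i

FamEmpty : (n i : ℕ) → Set
FamEmpty n i = ¬ ∃ (InFam n i)

FamNonempty : (n i : ℕ) → Set
FamNonempty n i = ∃ (InFam n i)

liftS : {k : ℕ} → Subset k → Subset (suc k)
liftS X = X ∷ʳ false

-- X ∪ {n-1} for X ⊆ [m], n = m + 2  (vertex m+1 is index m)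
addPen : (m : ℕ) → Subset m → Subset (suc (suc m))
addPen m X = liftS (liftS X) ∪ ⁅ inject₁ (fromℕ m) ⁆

-- {n} ∪ X for X ⊆ [m+1], n = m + 2  (vertex m+2 is index m+1)
addLast : (m : ℕ) → Subset (suc m) → Subset (suc (suc m))
addLast m X = ⁅ fromℕ (suc m) ⁆ ∪ liftS X

module Submission where

-- Every edge of P_n is a bridge, so the spanning subgraph keeping the edges
-- with an endpoint in S is connected iff it keeps all edges, i.e. iff S is a
-- vertex cover of P_n (connected⇔pathCover; connectivity ⇒ cover because a
-- walk from a vertex ≤ k to one > k must use the edge {k, k+1}).  Hence for
-- i ≥ 1, 𝒫_n^i is the family of i-vertex covers of P_n (wcds⇔sizedCover).
-- A cover of P_{m+2} either contains the last vertex, the rest being a cover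
-- of P_{m+1}, or omits it and then contains the penultimate vertex, the rest
-- being a cover of P_m (sizedCover-split).  Identifying these extensions with
-- {n} ∪ X and X ∪ {n-1} gives part (ii); part (i) is the same decomposition
-- with the first alternative excluded.

open import Defs
open import Data.Nat using (ℕ; suc; _≤_; _/_; _∸_)
open import Data.Fin.Subset using (Subset)
open import Data.Product using (_×_; ∃)
open import Data.Sum using (_⊎_)
open import Relation.Binary.PropositionalEquality using (_≡_)
open import Function.Bundles using (_⇔_)

open import Data.Nat using (zero; _<_; z≤n; s≤s; _≤?_)
open import Data.Nat.Properties
  using (≤-refl; ≤-reflexive; ≤-trans; ≤-antisym; ≤-pred; ≰⇒>; <⇒≱; <-asym; suc-injective)
open import Data.Fin using (Fin; zero; suc; toℕ; fromℕ; inject₁)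
open import Data.Fin.Properties using (toℕ-injective)
open import Data.Fin.Subset using (_∈_; Nonempty; ∣_∣; _∪_; ⁅_⁆; ⊥)
open import Data.Fin.Subset.Properties
  using (drop-there; x∈p⇒∣p-x∣<∣p∣; nonempty?; Empty-unique; ∣⊥∣≡0; ∪-identityˡ; ∪-identityʳ)
open import Data.Vec.Base using (Vec; []; _∷_; _∷ʳ_; zipWith; initLast; here; there)
open import Data.Bool using (true; false; _∨_)
open import Data.Unit using (⊤; tt)
open import Data.Empty using (⊥-elim)
open import Data.Product using (_,_; proj₁; proj₂; ∃₂; uncurry)
open import Data.Sum using (inj₁; inj₂; [_,_]′) renaming (map to ⊎-map; swap to ⊎-swap)
open import Data.Sum.Function.Propositional using (_⊎-⇔_)
open import Relation.Binary.PropositionalEquality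
  using (refl; sym; trans; cong; subst; subst₂; module ≡-Reasoning)
open import Relation.Binary.Construct.Closure.ReflexiveTransitive using (Star; ε; _◅_; _◅◅_; gmap)
open import Relation.Nullary using (¬_; yes; no)
open import Function using (id; _∘_)
open import Function.Bundles using (mk⇔; Equivalence)
open import Function.Properties.Equivalence using () renaming (sym to ⇔-sym; trans to ⇔-trans)

open Equivalence using (to; from)

PathCover : ∀ {n} → Subset n → Set
PathCover []          = ⊤
PathCover (_ ∷ [])    = ⊤
PathCover (a ∷ b ∷ S) = (a ≡ true ⊎ b ≡ true) × PathCover (b ∷ S)

EdgesCovered : ∀ {n} → Subset n → Set
EdgesCovered {n} S = ∀ (x y : Fin n) → toℕ y ≡ suc (toℕ x) → x ∈ S ⊎ y ∈ S

SizedCover : (n i : ℕ) → Subset n → Set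
SizedCover n i S = PathCover S × ∣ S ∣ ≡ i

first-edge-covered : ∀ {n a b} {S : Subset n} →
  (a ≡ true ⊎ b ≡ true) ⇔ (zero ∈ (a ∷ b ∷ S) ⊎ suc zero ∈ (a ∷ b ∷ S))
first-edge-covered = mk⇔ forward backward
  where
  forward : ∀ {n a b} {S : Subset n} →
    a ≡ true ⊎ b ≡ true → zero ∈ (a ∷ b ∷ S) ⊎ suc zero ∈ (a ∷ b ∷ S)
  forward (inj₁ refl) = inj₁ here
  forward (inj₂ refl) = inj₂ (there here)
  backward : ∀ {n a b} {S : Subset n} →
    zero ∈ (a ∷ b ∷ S) ⊎ suc zero ∈ (a ∷ b ∷ S) → a ≡ true ⊎ b ≡ true
  backward (inj₁ here)         = inj₁ refl
  backward (inj₂ (there here)) = inj₂ refl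

edgesCovered⇒pathCover : ∀ {n} (S : Subset n) → EdgesCovered S → PathCover S
edgesCovered⇒pathCover []          _   = tt
edgesCovered⇒pathCover (_ ∷ [])    _   = tt
edgesCovered⇒pathCover (a ∷ b ∷ S) cov =
  from first-edge-covered (cov zero (suc zero) refl) ,
  edgesCovered⇒pathCover (b ∷ S)
    (λ x y y≡x+1 → ⊎-map drop-there drop-there (cov (suc x) (suc y) (cong suc y≡x+1)))

walk-crosses : ∀ {A : Set} {R : A → A → Set} (level : A → ℕ) (k : ℕ) {u v : A} →
  Star R u v → level u ≤ k → k < level v →
  ∃₂ λ x y → R x y × level x ≤ k × k < level y
walk-crosses level k ε u≤k k<u = ⊥-elim (<⇒≱ k<u u≤k)
walk-crosses level k (_◅_ {j = w} step rest) u≤k k<v with level w ≤? k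
... | yes w≤k = walk-crosses level k rest w≤k k<v
... | no  w≰k = _ , _ , step , u≤k , ≰⇒> w≰k

crossing-path-edge : ∀ {n k} {x y : Fin n} →
  PathAdj n x y → toℕ x ≤ k → k < toℕ y → toℕ x ≡ k × toℕ y ≡ suc k
crossing-path-edge {k = k} {x} (inj₁ y≡x+1) x≤k k<y =
  x≡k , trans y≡x+1 (cong suc x≡k)
  where
  x≡k : toℕ x ≡ k
  x≡k = ≤-antisym x≤k (≤-pred (subst (k <_) y≡x+1 k<y))
crossing-path-edge {k = k} (inj₂ x≡y+1) x≤k k<y =
  ⊥-elim (<-asym k<y (subst (_≤ k) x≡y+1 x≤k))

-- Every edge of P_n is a bridge, so connectivity forces every edge to be kept.
connected⇒edgesCovered : ∀ {n} (S : Subset n) → Connected n (WeakAdj n S) → EdgesCovered S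
connected⇒edgesCovered S conn x y y≡x+1
  with walk-crosses toℕ (toℕ x) (conn x y) ≤-refl (subst (toℕ x <_) (sym y≡x+1) ≤-refl)
... | x′ , y′ , (adj , kept) , x′≤x , x<y′ with crossing-path-edge adj x′≤x x<y′
...   | x′≡x , y′≡x+1 =
  subst₂ (λ p q → p ∈ S ⊎ q ∈ S) (toℕ-injective x′≡x) (toℕ-injective (trans y′≡x+1 (sym y≡x+1))) kept

weakAdj-sym : ∀ {n} {S : Subset n} {u v} → WeakAdj n S u v → WeakAdj n S v u
weakAdj-sym (adj , kept) = ⊎-swap adj , ⊎-swap kept

weakAdj-suc : ∀ {n a} {S : Subset n} {u v} →
  WeakAdj n S u v → WeakAdj (suc n) (a ∷ S) (suc u) (suc v)
weakAdj-suc (adj , kept) = ⊎-map (cong suc) (cong suc) adj , ⊎-map there there kept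

-- By induction on the path: vertex 1 joins the tail through the kept edge {1,2}.
pathCover⇒connected : ∀ {n} (S : Subset n) → PathCover S → Connected n (WeakAdj n S)
pathCover⇒connected (_ ∷ [])    _ zero zero = ε
pathCover⇒connected {suc (suc n)} (a ∷ b ∷ S) (first , rest) = walk
  where
  T : Subset (suc (suc n))
  T = a ∷ b ∷ S
  tail-walk : ∀ u v → Star (WeakAdj (suc (suc n)) T) (suc u) (suc v)
  tail-walk u v = gmap suc weakAdj-suc (pathCover⇒connected (b ∷ S) rest u v)
  first-edge : WeakAdj (suc (suc n)) T zero (suc zero)
  first-edge = inj₁ refl , to first-edge-covered first
  walk : Connected (suc (suc n)) (WeakAdj (suc (suc n)) T)
  walk zero    zero    = ε
  walk zero    (suc v) = first-edge ◅ tail-walk zero v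
  walk (suc u) zero    = tail-walk u zero ◅◅ (weakAdj-sym first-edge ◅ ε)
  walk (suc u) (suc v) = tail-walk u v

connected⇔pathCover : ∀ {n} (S : Subset n) → Connected n (WeakAdj n S) ⇔ PathCover S
connected⇔pathCover S =
  mk⇔ (λ conn → edgesCovered⇒pathCover S (connected⇒edgesCovered S conn)) (pathCover⇒connected S)

nonempty⇒size≥1 : ∀ {n} {S : Subset n} → Nonempty S → 1 ≤ ∣ S ∣
nonempty⇒size≥1 (_ , x∈S) = ≤-trans (s≤s z≤n) (x∈p⇒∣p-x∣<∣p∣ x∈S)

size≥1⇒nonempty : ∀ {n} (S : Subset n) → 1 ≤ ∣ S ∣ → Nonempty S
size≥1⇒nonempty {n} S size≥1 with nonempty? S
... | yes nonempty = nonempty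
... | no  empty    =
  ⊥-elim (<⇒≱ size≥1 (≤-reflexive (trans (cong ∣_∣ (Empty-unique empty)) (∣⊥∣≡0 n))))

no-wcds-of-size-0 : ∀ {n} → ¬ FamNonempty n 0
no-wcds-of-size-0 (_ , (nonempty , _) , size≡0) =
  <⇒≱ (subst (1 ≤_) size≡0 (nonempty⇒size≥1 nonempty)) z≤n

wcds⇔sizedCover : ∀ {n k} (S : Subset n) → InFam n (suc k) S ⇔ SizedCover n (suc k) S
wcds⇔sizedCover S = mk⇔
  (λ { ((_ , conn) , size) → to (connected⇔pathCover S) conn , size })
  (λ { (cover , size) →
    (size≥1⇒nonempty S (subst (1 ≤_) (sym size) (s≤s z≤n)) , from (connected⇔pathCover S) cover) , size })

pathCover-init : ∀ {n} (S : Subset n) b → PathCover (S ∷ʳ b) → PathCover S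
pathCover-init []          _ _              = tt
pathCover-init (_ ∷ [])    _ _              = tt
pathCover-init (a ∷ c ∷ S) b (first , rest) = first , pathCover-init (c ∷ S) b rest

pathCover-∷ʳ-true : ∀ {n} (S : Subset n) → PathCover S → PathCover (S ∷ʳ true)
pathCover-∷ʳ-true []          _              = tt
pathCover-∷ʳ-true (_ ∷ [])    _              = inj₂ refl , tt
pathCover-∷ʳ-true (a ∷ c ∷ S) (first , rest) = first , pathCover-∷ʳ-true (c ∷ S) rest

pathCover-∷ʳ : ∀ {n} (S : Subset n) a b →
  PathCover ((S ∷ʳ a) ∷ʳ b) ⇔ (PathCover (S ∷ʳ a) × (a ≡ true ⊎ b ≡ true))
pathCover-∷ʳ S a b = mk⇔ (split S) (uncurry (join S))
  where
  split : ∀ {n} (S : Subset n) → PathCover ((S ∷ʳ a) ∷ʳ b) → PathCover (S ∷ʳ a) × (a ≡ true ⊎ b ≡ true)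
  split []          (new , _)      = tt , new
  split (_ ∷ [])    (first , rest) = (first , tt) , proj₂ (split [] rest)
  split (c ∷ d ∷ S) (first , rest) = (first , proj₁ (split (d ∷ S) rest)) , proj₂ (split (d ∷ S) rest)
  join : ∀ {n} (S : Subset n) → PathCover (S ∷ʳ a) → a ≡ true ⊎ b ≡ true → PathCover ((S ∷ʳ a) ∷ʳ b)
  join []          _              new = new , tt
  join (_ ∷ [])    (first , _)    new = first , join [] tt new
  join (c ∷ d ∷ S) (first , rest) new = first , join (d ∷ S) rest new

∣∷ʳ-true∣ : ∀ {n} (S : Subset n) → ∣ S ∷ʳ true ∣ ≡ suc ∣ S ∣
∣∷ʳ-true∣ []          = refl
∣∷ʳ-true∣ (true ∷ S)  = cong suc (∣∷ʳ-true∣ S)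
∣∷ʳ-true∣ (false ∷ S) = ∣∷ʳ-true∣ S

∣∷ʳ-false∣ : ∀ {n} (S : Subset n) → ∣ S ∷ʳ false ∣ ≡ ∣ S ∣
∣∷ʳ-false∣ []          = refl
∣∷ʳ-false∣ (true ∷ S)  = cong suc (∣∷ʳ-false∣ S)
∣∷ʳ-false∣ (false ∷ S) = ∣∷ʳ-false∣ S

sizedCover-last : ∀ {n j} (S : Subset n) → SizedCover (suc n) (suc j) (S ∷ʳ true) ⇔ SizedCover n j S
sizedCover-last S = mk⇔
  (λ { (cover , size) → pathCover-init S true cover , suc-injective (trans (sym (∣∷ʳ-true∣ S)) size) })
  (λ { (cover , size) → pathCover-∷ʳ-true S cover , trans (∣∷ʳ-true∣ S) (cong suc size) })

-- A cover of P_{n+2} omitting the last vertex must contain the penultimate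
-- one; such covers of size j+1 are the covers of P_n of size j, extended by
-- the penultimate vertex.
sizedCover-penultimate : ∀ {n j} (S : Subset n) a →
  SizedCover (suc (suc n)) (suc j) ((S ∷ʳ a) ∷ʳ false) ⇔ (a ≡ true × SizedCover n j S)
sizedCover-penultimate {n} {j} S a = mk⇔ forward backward
  where
  size≡ : ∣ (S ∷ʳ true) ∷ʳ false ∣ ≡ suc ∣ S ∣
  size≡ = trans (∣∷ʳ-false∣ (S ∷ʳ true)) (∣∷ʳ-true∣ S)
  forward : SizedCover (suc (suc n)) (suc j) ((S ∷ʳ a) ∷ʳ false) → a ≡ true × SizedCover n j S
  forward (cover , size) with to (pathCover-∷ʳ S a false) cover
  ... | coverₐ , inj₁ refl =
    refl , pathCover-init S true coverₐ , suc-injective (trans (sym size≡) size)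
  ... | _      , inj₂ ()
  backward : a ≡ true × SizedCover n j S → SizedCover (suc (suc n)) (suc j) ((S ∷ʳ a) ∷ʳ false)
  backward (refl , cover , size) =
    from (pathCover-∷ʳ S true false) (pathCover-∷ʳ-true S cover , inj₁ refl) ,
    trans size≡ (cong suc size)

sizedCover-split : ∀ {m j} (S : Subset (suc (suc m))) →
  SizedCover (suc (suc m)) (suc j) S ⇔
    ((∃ λ X₁ → SizedCover (suc m) j X₁ × S ≡ X₁ ∷ʳ true)
     ⊎ (∃ λ X₂ → SizedCover m j X₂ × S ≡ (X₂ ∷ʳ true) ∷ʳ false))
sizedCover-split {m} {j} S = mk⇔ (decompose S) compose
  where
  decompose : (S : Subset (suc (suc m))) → SizedCover (suc (suc m)) (suc j) S →
    (∃ λ X₁ → SizedCover (suc m) j X₁ × S ≡ X₁ ∷ʳ true)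
    ⊎ (∃ λ X₂ → SizedCover m j X₂ × S ≡ (X₂ ∷ʳ true) ∷ʳ false)
  decompose S cover with initLast S
  ... | Y , true  , refl = inj₁ (Y , to (sizedCover-last Y) cover , refl)
  ... | Y , false , refl with initLast Y
  ...   | X , a , refl with to (sizedCover-penultimate X a) cover
  ...     | refl , coverₓ = inj₂ (X , coverₓ , refl)
  compose : (∃ λ X₁ → SizedCover (suc m) j X₁ × S ≡ X₁ ∷ʳ true)
    ⊎ (∃ λ X₂ → SizedCover m j X₂ × S ≡ (X₂ ∷ʳ true) ∷ʳ false) →
    SizedCover (suc (suc m)) (suc j) S
  compose (inj₁ (X₁ , cover , refl)) = from (sizedCover-last X₁) cover
  compose (inj₂ (X₂ , cover , refl)) = from (sizedCover-penultimate X₂ true) (refl , cover)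

zipWith-∷ʳ : ∀ {A B C : Set} {n} (f : A → B → C) (xs : Vec A n) (ys : Vec B n) x y →
  zipWith f (xs ∷ʳ x) (ys ∷ʳ y) ≡ zipWith f xs ys ∷ʳ f x y
zipWith-∷ʳ f []       []       x y = refl
zipWith-∷ʳ f (a ∷ xs) (b ∷ ys) x y = cong (f a b ∷_) (zipWith-∷ʳ f xs ys x y)

⊥-∷ʳ-false : ∀ n → ⊥ {n} ∷ʳ false ≡ ⊥ {suc n}
⊥-∷ʳ-false zero    = refl
⊥-∷ʳ-false (suc n) = cong (false ∷_) (⊥-∷ʳ-false n)

⁅fromℕ⁆ : ∀ n → ⁅ fromℕ n ⁆ ≡ ⊥ {n} ∷ʳ true
⁅fromℕ⁆ zero    = refl
⁅fromℕ⁆ (suc n) = cong (false ∷_) (⁅fromℕ⁆ n)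

⁅inject₁⁆ : ∀ {n} (x : Fin n) → ⁅ inject₁ x ⁆ ≡ ⁅ x ⁆ ∷ʳ false
⁅inject₁⁆ {suc n} zero = cong (true ∷_) (sym (⊥-∷ʳ-false n))
⁅inject₁⁆ (suc x)      = cong (false ∷_) (⁅inject₁⁆ x)

addLast≡ : ∀ m (X : Subset (suc m)) → addLast m X ≡ X ∷ʳ true
addLast≡ m X = begin
  ⁅ fromℕ (suc m) ⁆ ∪ (X ∷ʳ false) ≡⟨ cong (_∪ (X ∷ʳ false)) (⁅fromℕ⁆ (suc m)) ⟩
  (⊥ ∷ʳ true) ∪ (X ∷ʳ false)       ≡⟨ zipWith-∷ʳ _∨_ ⊥ X true false ⟩
  (⊥ ∪ X) ∷ʳ true                  ≡⟨ cong (_∷ʳ true) (∪-identityˡ X) ⟩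
  X ∷ʳ true                        ∎
  where open ≡-Reasoning

addPen≡ : ∀ m (X : Subset m) → addPen m X ≡ (X ∷ʳ true) ∷ʳ false
addPen≡ m X = begin
  ((X ∷ʳ false) ∷ʳ false) ∪ ⁅ inject₁ (fromℕ m) ⁆
    ≡⟨ cong (((X ∷ʳ false) ∷ʳ false) ∪_) (trans (⁅inject₁⁆ (fromℕ m)) (cong (_∷ʳ false) (⁅fromℕ⁆ m))) ⟩
  ((X ∷ʳ false) ∷ʳ false) ∪ ((⊥ ∷ʳ true) ∷ʳ false)
    ≡⟨ zipWith-∷ʳ _∨_ (X ∷ʳ false) (⊥ ∷ʳ true) false false ⟩
  ((X ∷ʳ false) ∪ (⊥ ∷ʳ true)) ∷ʳ false
    ≡⟨ cong (_∷ʳ false) (zipWith-∷ʳ _∨_ X ⊥ false true) ⟩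
  ((X ∪ ⊥) ∷ʳ true) ∷ʳ false
    ≡⟨ cong (λ Y → (Y ∷ʳ true) ∷ʳ false) (∪-identityʳ X) ⟩
  (X ∷ʳ true) ∷ʳ false
    ∎
  where open ≡-Reasoning

∃-cong : ∀ {n k} {A B : Subset n → Set} {f g : Subset n → Subset k} {S : Subset k} →
  (∀ X → A X ⇔ B X) → (∀ X → f X ≡ g X) →
  ∃ (λ X → A X × S ≡ f X) ⇔ ∃ (λ X → B X × S ≡ g X)
∃-cong A⇔B f≡g = mk⇔
  (λ { (X , a , S≡fX) → X , to (A⇔B X) a , trans S≡fX (f≡g X) })
  (λ { (X , b , S≡gX) → X , from (A⇔B X) b , trans S≡gX (sym (f≡g X)) })

wcds-split : ∀ m k (S : Subset (suc (suc m))) →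
  InFam (suc (suc m)) (suc (suc k)) S ⇔
    (∃ (λ X₁ → InFam (suc m) (suc k) X₁ × S ≡ addLast m X₁)
     ⊎ ∃ (λ X₂ → InFam m (suc k) X₂ × S ≡ addPen m X₂))
wcds-split m k S =
  ⇔-trans (wcds⇔sizedCover S)
    (⇔-trans (sizedCover-split S)
      (∃-cong (⇔-sym ∘ wcds⇔sizedCover) (sym ∘ addLast≡ m)
       ⊎-⇔ ∃-cong (⇔-sym ∘ wcds⇔sizedCover) (sym ∘ addPen≡ m)))

theorem3p6 : (m i : ℕ) → 1 ≤ m → suc (suc m) / 2 ≤ i →
    ((FamEmpty (suc m) (i ∸ 1) → FamNonempty m (i ∸ 1) →
       (S : Subset (suc (suc m))) →
         InFam (suc (suc m)) i S ⇔ ∃ (λ X → InFam m (i ∸ 1) X × S ≡ addPen m X))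
    × (FamNonempty (suc m) (i ∸ 1) → FamNonempty m (i ∸ 1) →
       (S : Subset (suc (suc m))) →
         InFam (suc (suc m)) i S ⇔
           (∃ (λ X₁ → InFam (suc m) (i ∸ 1) X₁ × S ≡ addLast m X₁)
            ⊎ ∃ (λ X₂ → InFam m (i ∸ 1) X₂ × S ≡ addPen m X₂))))
-- For i ≤ 1 the hypothesis 𝒫_m^{i-1} ≠ ∅ fails, so both parts are vacuous.
theorem3p6 m zero          _ _ =
  (λ _ nonempty → ⊥-elim (no-wcds-of-size-0 nonempty)) ,
  (λ _ nonempty → ⊥-elim (no-wcds-of-size-0 nonempty))
theorem3p6 m (suc zero)    _ _ =
  (λ _ nonempty → ⊥-elim (no-wcds-of-size-0 nonempty)) ,
  (λ _ nonempty → ⊥-elim (no-wcds-of-size-0 nonempty))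
-- For i ≥ 2, part (ii) is the decomposition wcds-split; part (i) is the
-- same decomposition with the {n} ∪ X₁ alternative excluded by 𝒫_{n-1}^{i-1} = ∅.
theorem3p6 m (suc (suc k)) _ _ = part-i , (λ _ _ → wcds-split m k)
  where
  part-i : FamEmpty (suc m) (suc k) → FamNonempty m (suc k) → (S : Subset (suc (suc m))) →
    InFam (suc (suc m)) (suc (suc k)) S ⇔ ∃ (λ X → InFam m (suc k) X × S ≡ addPen m X)
  part-i no-X₁ _ S = mk⇔
    (λ inS → [ (λ { (X₁ , inX₁ , _) → ⊥-elim (no-X₁ (X₁ , inX₁)) }) , id ]′ (to (wcds-split m k S) inS))
    (λ pen → from (wcds-split m k S) (inj₂ pen))
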